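{- For every $n\ge 0$, $$sc_2(\mathcal{D}_n)=\sum_{\gamma\in\mathcal{D}_n}\Big(2\cdot\#(du,du)_\gamma+\#(ddu)_\gamma+\#(duu)_\gamma\Big),$$ where $sc_2(\mathcal{D}_n)$ is the number of saturated chains of length 2 in $\mathcal{D}_n$.
   Context: A Dyck path of semilength $n$ is a word in $u$ (step $(1,1)$) and $d$ (step $(1,-1)$) with $n$ of each letter whose path from the origin never goes below the $x$-axis. $\mathcal{D}_n$ is the set of such paths ordered by $\gamma\le\gamma'$ iff $\gamma$ lies weakly below $\gamma'$. A saturated chain of length $h$ is a chain $\gamma^{(0)}<\cdots<\gamma^{(h)}$ where each element covers the previous one. For words $w_1,\ldots,w_k$, $\#(w_1,\ldots,w_k)_\gamma$ denotes the number of ways of choosing pairwise disjoint occurrences (as blocks of consecutive letters) of $w_1,\ldots,w_k$ in $\gamma$, taken as unordered collections; in particular $\#(du,du)_\gamma$ is the number of unordered pairs of distinct valleys ($du$ factors) of $\gamma$, and $\#(w)_\gamma$ is the number of occurrences of the factor $w$ in $\gamma$. -}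

module Defs where

open import Data.Bool using (Bool; true; false; _∧_; _∨_; not; if_then_else_)
open import Data.Nat using (ℕ; zero; suc; _+_; _*_; _≤ᵇ_; _≡ᵇ_)
open import Data.Integer as ℤ using (ℤ; +_; -[1+_])
open import Data.List using (List; []; _∷_; _++_; map; filter; length; concatMap; foldr)
open import Data.Nat.ListAction using (sum)
open import Relation.Nullary.Decidable using (does)
open import Relation.Unary using (Decidable)
open import Relation.Binary.PropositionalEquality using (_≡_)
open import Data.Bool.Properties using (T?)
open import Data.Bool using (T)

-- Steps: u = (1,1), d = (1,-1)
data Step : Set where
  u d : Step

Word : Set
Word = List Step

stepEq : Step → Step → Bool
stepEq u u = true
stepEq d d = true
stepEq _ _ = false

wordEq : Word → Word → Bool
wordEq [] [] = true
wordEq (x ∷ xs) (y ∷ ys) = stepEq x y ∧ wordEq xs ys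
wordEq _ _ = false

words : ℕ → List Word
words zero = [] ∷ []
words (suc k) = concatMap (λ w → (u ∷ w) ∷ (d ∷ w) ∷ []) (words k)

stepVal : Step → ℤ
stepVal u = + 1
stepVal d = -[1+ 0 ]

heightsFrom : ℤ → Word → List ℤ
heightsFrom h [] = h ∷ []
heightsFrom h (s ∷ w) = h ∷ heightsFrom (h ℤ.+ stepVal s) w

heights : Word → List ℤ
heights = heightsFrom (+ 0)

allB : List Bool → Bool
allB = foldr _∧_ true

countU : Word → ℕ
countU [] = 0
countU (u ∷ w) = suc (countU w)
countU (d ∷ w) = countU w

countD : Word → ℕ
countD [] = 0
countD (d ∷ w) = suc (countD w)
countD (u ∷ w) = countD w

isDyck : ℕ → Word → Bool
isDyck n w = (countU w ≡ᵇ n) ∧ (countD w ≡ᵇ n)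
             ∧ allB (map (λ h → does (+ 0 ℤ.≤? h)) (heights w))

Dyck : ℕ → List Word
Dyck n = filter (λ w → T? (isDyck n w)) (words (2 * n))

leList : List ℤ → List ℤ → Bool
leList [] [] = true
leList (x ∷ xs) (y ∷ ys) = does (x ℤ.≤? y) ∧ leList xs ys
leList _ _ = false

_≤D_ : Word → Word → Bool
γ ≤D γ' = leList (heights γ) (heights γ')

_<D_ : Word → Word → Bool
γ <D γ' = (γ ≤D γ') ∧ not (wordEq γ γ')

anyB : List Bool → Bool
anyB = foldr _∨_ false

covers : ℕ → Word → Word → Bool
covers n γ γ' = (γ <D γ') ∧ not (anyB (map (λ δ → (γ <D δ) ∧ (δ <D γ')) (Dyck n)))

sc2 : ℕ → ℕ
sc2 n = length (filter (λ t → T? (chk t))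
          (concatMap (λ a → concatMap (λ b → map (λ c → a ∷ b ∷ c ∷ []) (Dyck n)) (Dyck n)) (Dyck n)))
  where
  chk : List Word → Bool
  chk (a ∷ b ∷ c ∷ []) = covers n a b ∧ covers n b c
  chk _ = false

isPrefix : Word → Word → Bool
isPrefix [] _ = true
isPrefix (x ∷ xs) [] = false
isPrefix (x ∷ xs) (y ∷ ys) = stepEq x y ∧ isPrefix xs ys

occAux : Word → ℕ → Word → List ℕ
occAux w i [] = if isPrefix w [] then i ∷ [] else []
occAux w i (s ∷ γ) = (if isPrefix w (s ∷ γ) then i ∷ [] else []) ++ occAux w (suc i) γ

occurrences : Word → Word → List ℕ
occurrences w γ = occAux w 0 γ

#occ : Word → Word → ℕ
#occ w γ = length (occurrences w γ)

-- #(w,w)_γ : unordered pairs of disjoint occurrences of w (positions i < j with i + |w| ≤ j)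
#occPair : Word → Word → ℕ
#occPair w γ = length (filter (λ p → T? (p))
  (concatMap (λ i → map (λ j → (i + length w) ≤ᵇ j) (occurrences w γ)) (occurrences w γ)))

sumOver : List Word → (Word → ℕ) → ℕ
sumOver xs f = sum (map f xs)

-- In the lattice of Dyck paths, δ covers γ exactly when δ arises from γ by turning one valley du
-- into a peak ud. So a path has as many upper covers as valleys, and sc₂ counts pairs (γ, δ) with
-- δ a flip of γ, each weighted by the number of valleys of δ. Flipping a valley of γ destroys it
-- and keeps the others; it creates a new valley on its left when it ends a factor ddu, and one on
-- its right when it starts a factor duu. Summing over the v valleys of γ gives
-- v(v − 1) + #(ddu) + #(duu), and v(v − 1) = 2·#(du,du) because valleys never overlap.
module Submission where

open import Defs

open import Algebra.Properties.CommutativeSemigroup using (interchange)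
open import Data.Bool using (Bool; true; false; _∧_; not; if_then_else_)
open import Data.Bool.Properties using (T?; T-≡; ∧-conicalˡ; ∧-conicalʳ; ∨-conicalˡ; ∨-conicalʳ; not-injective)
open import Data.Empty using (⊥-elim)
open import Data.Integer as ℤ using (ℤ; 0ℤ; 1ℤ; -1ℤ; -<+)
import Data.Integer.Properties as ℤ
import Data.Integer.Tactic.RingSolver as ℤ-Ring
import Data.Nat.Tactic.RingSolver as ℕ-Ring
open import Data.List using (List; []; _∷_; _++_; map; concatMap; filter; length)
open import Data.List.Properties using (map-++; length-++; length-map)
open import Data.List.Membership.Propositional using (_∈_)
open import Data.List.Membership.Propositional.Properties using (∈-filter⁻; ∈-map⁻)
open import Data.List.Relation.Unary.All as All using (All; []; _∷_)
open import Data.List.Relation.Unary.AllPairs using (AllPairs; []; _∷_)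
open import Data.List.Relation.Unary.Any using (here; there)
open import Data.Nat as ℕ using (ℕ; zero; suc; _+_; _*_; _≤_; _<_; _≤ᵇ_)
open import Data.Nat.Combinatorics using (_C_; nC1≡n; nCk+nC[k+1]≡[n+1]C[k+1])
open import Data.Nat.ListAction using (sum)
open import Data.Nat.ListAction.Properties using (sum-++)
open import Data.Nat.Properties
  using (+-comm; +-suc; +-identityʳ; *-identityˡ; *-identityʳ; *-distribˡ-+; *-distribʳ-+; *-zeroʳ;
         m+1+n≢0; 1+n≢0; m+1+n≰m; m≤m+n; n≤1+n; ≤-refl; ≤-trans; suc-injective; ≡⇒≡ᵇ; +-commutativeSemigroup)
open import Data.Product using (Σ; _×_; _,_; proj₁; proj₂)
open import Data.Sum as Sum using (_⊎_; inj₁; inj₂)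
open import Function using (_∘_; Equivalence)
open import Relation.Nullary using (¬_; Dec; does; yes; no)
open import Relation.Nullary.Decidable using (dec-true; dec-false)
open import Relation.Binary.PropositionalEquality

𝟙 : Bool → ℕ
𝟙 true  = 1
𝟙 false = 0

𝟙-∧ : ∀ x y → 𝟙 (x ∧ y) ≡ 𝟙 x * 𝟙 y
𝟙-∧ true  y = sym (*-identityˡ (𝟙 y))
𝟙-∧ false y = refl

module _ {A : Set} where

  ∑ : List A → (A → ℕ) → ℕ
  ∑ xs f = sum (map f xs)

  infix 6.5 ∑
  syntax ∑ xs (λ x → e) = ∑[ x ∈ xs ] e

  ∑-++ : ∀ xs ys (f : A → ℕ) → ∑ (xs ++ ys) f ≡ ∑ xs f + ∑ ys f
  ∑-++ xs ys f = trans (cong sum (map-++ f xs ys)) (sum-++ (map f xs) (map f ys))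

  ∑-cong : ∀ xs {f g : A → ℕ} → (∀ {x} → x ∈ xs → f x ≡ g x) → ∑ xs f ≡ ∑ xs g
  ∑-cong []       f≡g = refl
  ∑-cong (x ∷ xs) f≡g = cong₂ _+_ (f≡g (here refl)) (∑-cong xs (f≡g ∘ there))

  ∑-0 : ∀ xs → ∑[ x ∈ xs ] 0 ≡ 0
  ∑-0 []       = refl
  ∑-0 (x ∷ xs) = ∑-0 xs

  ∑-1 : ∀ xs → ∑[ x ∈ xs ] 1 ≡ length xs
  ∑-1 []       = refl
  ∑-1 (x ∷ xs) = cong suc (∑-1 xs)

  ∑-+ : ∀ xs (f g : A → ℕ) → ∑[ x ∈ xs ] (f x + g x) ≡ ∑ xs f + ∑ xs g
  ∑-+ []       f g = refl
  ∑-+ (x ∷ xs) f g = trans (cong ((f x + g x) +_) (∑-+ xs f g))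
                           (interchange +-commutativeSemigroup (f x) (g x) (∑ xs f) (∑ xs g))

  ∑-*ˡ : ∀ xs c (f : A → ℕ) → ∑[ x ∈ xs ] (c * f x) ≡ c * ∑ xs f
  ∑-*ˡ []       c f = sym (*-zeroʳ c)
  ∑-*ˡ (x ∷ xs) c f = trans (cong (c * f x +_) (∑-*ˡ xs c f)) (sym (*-distribˡ-+ c (f x) (∑ xs f)))

  ∑-*ʳ : ∀ xs c (f : A → ℕ) → ∑[ x ∈ xs ] (f x * c) ≡ ∑ xs f * c
  ∑-*ʳ []       c f = refl
  ∑-*ʳ (x ∷ xs) c f = trans (cong (f x * c +_) (∑-*ʳ xs c f)) (sym (*-distribʳ-+ c (f x) (∑ xs f)))

  length-filter≡∑ : ∀ (p : A → Bool) xs → length (filter (λ x → T? (p x)) xs) ≡ ∑[ x ∈ xs ] 𝟙 (p x)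
  length-filter≡∑ p []       = refl
  length-filter≡∑ p (x ∷ xs) with p x
  ... | true  = cong suc (length-filter≡∑ p xs)
  ... | false = length-filter≡∑ p xs

module _ {A B : Set} where

  ∑-map : ∀ (g : A → B) xs (f : B → ℕ) → ∑ (map g xs) f ≡ ∑[ x ∈ xs ] f (g x)
  ∑-map g []       f = refl
  ∑-map g (x ∷ xs) f = cong (f (g x) +_) (∑-map g xs f)

  ∑-concatMap : ∀ (g : A → List B) xs (f : B → ℕ) → ∑ (concatMap g xs) f ≡ ∑[ x ∈ xs ] ∑ (g x) f
  ∑-concatMap g []       f = refl
  ∑-concatMap g (x ∷ xs) f = trans (∑-++ (g x) (concatMap g xs) f) (cong (∑ (g x) f +_) (∑-concatMap g xs f))

  ∑-comm : ∀ xs ys (f : A → B → ℕ) → ∑[ x ∈ xs ] ∑[ y ∈ ys ] f x y ≡ ∑[ y ∈ ys ] ∑[ x ∈ xs ] f x y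
  ∑-comm []       ys f = sym (∑-0 ys)
  ∑-comm (x ∷ xs) ys f = trans (cong (∑ ys (f x) +_) (∑-comm xs ys f))
                               (sym (∑-+ ys (f x) (λ y → ∑[ x ∈ xs ] f x y)))

-- The order on Dyck paths

wordEq⇒≡ : ∀ {γ δ} → wordEq γ δ ≡ true → γ ≡ δ
wordEq⇒≡ {[]}    {[]}    _ = refl
wordEq⇒≡ {u ∷ γ} {u ∷ δ} e = cong (u ∷_) (wordEq⇒≡ e)
wordEq⇒≡ {d ∷ γ} {d ∷ δ} e = cong (d ∷_) (wordEq⇒≡ e)

wordEq-refl : ∀ γ → wordEq γ γ ≡ true
wordEq-refl []      = refl
wordEq-refl (u ∷ γ) = wordEq-refl γ
wordEq-refl (d ∷ γ) = wordEq-refl γ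

wordEq-sym : ∀ γ δ → wordEq γ δ ≡ wordEq δ γ
wordEq-sym []      []      = refl
wordEq-sym []      (_ ∷ _) = refl
wordEq-sym (_ ∷ _) []      = refl
wordEq-sym (u ∷ γ) (u ∷ δ) = wordEq-sym γ δ
wordEq-sym (u ∷ γ) (d ∷ δ) = refl
wordEq-sym (d ∷ γ) (u ∷ δ) = refl
wordEq-sym (d ∷ γ) (d ∷ δ) = wordEq-sym γ δ

-- below k γ δ: starting 2k units higher than γ, the path δ never drops below γ.
below : ℕ → Word → Word → Bool
below k       []      []      = true
below k       (u ∷ γ) (u ∷ δ) = below k γ δ
below k       (d ∷ γ) (d ∷ δ) = below k γ δ
below k       (d ∷ γ) (u ∷ δ) = below (suc k) γ δ
below zero    (u ∷ γ) (d ∷ δ) = false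
below (suc k) (u ∷ γ) (d ∷ δ) = below k γ δ
below k       _       _       = false

private
  up-up : ∀ h g → (h ℤ.+ (g ℤ.+ g)) ℤ.+ 1ℤ ≡ (h ℤ.+ 1ℤ) ℤ.+ (g ℤ.+ g)
  up-up = ℤ-Ring.solve-∀

  down-down : ∀ h g → (h ℤ.+ (g ℤ.+ g)) ℤ.+ -1ℤ ≡ (h ℤ.+ -1ℤ) ℤ.+ (g ℤ.+ g)
  down-down = ℤ-Ring.solve-∀

  down-up : ∀ h g → (h ℤ.+ (g ℤ.+ g)) ℤ.+ 1ℤ ≡ (h ℤ.+ -1ℤ) ℤ.+ ((1ℤ ℤ.+ g) ℤ.+ (1ℤ ℤ.+ g))
  down-up = ℤ-Ring.solve-∀

  up-down : ∀ h g → (h ℤ.+ ((1ℤ ℤ.+ g) ℤ.+ (1ℤ ℤ.+ g))) ℤ.+ -1ℤ ≡ (h ℤ.+ 1ℤ) ℤ.+ (g ℤ.+ g)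
  up-down = ℤ-Ring.solve-∀

  up-down₀ : ∀ h → (h ℤ.+ (0ℤ ℤ.+ 0ℤ)) ℤ.+ -1ℤ ≡ h ℤ.+ -1ℤ
  up-down₀ = ℤ-Ring.solve-∀

leList-heightsFrom-≰ : ∀ {h h'} γ δ → ¬ h ℤ.≤ h' → leList (heightsFrom h γ) (heightsFrom h' δ) ≡ false
leList-heightsFrom-≰ {h} {h'} []      []      h≰h' rewrite dec-false (h ℤ.≤? h') h≰h' = refl
leList-heightsFrom-≰ {h} {h'} []      (_ ∷ _) h≰h' rewrite dec-false (h ℤ.≤? h') h≰h' = refl
leList-heightsFrom-≰ {h} {h'} (_ ∷ _) []      h≰h' rewrite dec-false (h ℤ.≤? h') h≰h' = refl
leList-heightsFrom-≰ {h} {h'} (_ ∷ _) (_ ∷ _) h≰h' rewrite dec-false (h ℤ.≤? h') h≰h' = refl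

leList-[]-heightsFrom : ∀ h δ → leList [] (heightsFrom h δ) ≡ false
leList-[]-heightsFrom h []      = refl
leList-[]-heightsFrom h (_ ∷ _) = refl

leList-heightsFrom-[] : ∀ h γ → leList (heightsFrom h γ) [] ≡ false
leList-heightsFrom-[] h []      = refl
leList-heightsFrom-[] h (_ ∷ _) = refl

≤?-above : ∀ h {h'} k → h' ≡ h ℤ.+ (ℤ.+ k ℤ.+ ℤ.+ k) → does (h ℤ.≤? h') ≡ true
≤?-above h {h'} k e = dec-true (h ℤ.≤? h') (subst (h ℤ.≤_) (sym e) (ℤ.i≤i+j h _))

leList-heightsFrom : ∀ k γ δ h {h'} → h' ≡ h ℤ.+ (ℤ.+ k ℤ.+ ℤ.+ k) →
                     leList (heightsFrom h γ) (heightsFrom h' δ) ≡ below k γ δ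
leList-heightsFrom k [] [] h e rewrite ≤?-above h k e = refl
leList-heightsFrom k [] (s ∷ δ) h e rewrite ≤?-above h k e = leList-[]-heightsFrom _ δ
leList-heightsFrom k (u ∷ γ) [] h e rewrite ≤?-above h k e = leList-heightsFrom-[] _ γ
leList-heightsFrom k (d ∷ γ) [] h e rewrite ≤?-above h k e = leList-heightsFrom-[] _ γ
leList-heightsFrom k (u ∷ γ) (u ∷ δ) h e rewrite ≤?-above h k e =
  leList-heightsFrom k γ δ (h ℤ.+ 1ℤ) (trans (cong (ℤ._+ 1ℤ) e) (up-up h (ℤ.+ k)))
leList-heightsFrom k (d ∷ γ) (d ∷ δ) h e rewrite ≤?-above h k e =
  leList-heightsFrom k γ δ (h ℤ.+ -1ℤ) (trans (cong (ℤ._+ -1ℤ) e) (down-down h (ℤ.+ k)))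
leList-heightsFrom k (d ∷ γ) (u ∷ δ) h e rewrite ≤?-above h k e =
  leList-heightsFrom (suc k) γ δ (h ℤ.+ -1ℤ) (trans (cong (ℤ._+ 1ℤ) e) (down-up h (ℤ.+ k)))
leList-heightsFrom (suc k) (u ∷ γ) (d ∷ δ) h e rewrite ≤?-above h (suc k) e =
  leList-heightsFrom k γ δ (h ℤ.+ 1ℤ) (trans (cong (ℤ._+ -1ℤ) e) (up-down h (ℤ.+ k)))
leList-heightsFrom zero (u ∷ γ) (d ∷ δ) h e rewrite ≤?-above h zero e =
  leList-heightsFrom-≰ γ δ λ rise≤fall →
    ℤ.<⇒≱ (ℤ.+-monoʳ-< h -<+) (subst (h ℤ.+ 1ℤ ℤ.≤_) (trans (cong (ℤ._+ -1ℤ) e) (up-down₀ h)) rise≤fall)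

≤D≡below : ∀ γ δ → (γ ≤D δ) ≡ below 0 γ δ
≤D≡below γ δ = leList-heightsFrom 0 γ δ 0ℤ refl

below-refl : ∀ k γ → below k γ γ ≡ true
below-refl k []      = refl
below-refl k (u ∷ γ) = below-refl k γ
below-refl k (d ∷ γ) = below-refl k γ

below-antisym : ∀ γ δ → below 0 γ δ ≡ true → below 0 δ γ ≡ true → γ ≡ δ
below-antisym []      []      _ _ = refl
below-antisym (u ∷ γ) (u ∷ δ) p q = cong (u ∷_) (below-antisym γ δ p q)
below-antisym (d ∷ γ) (d ∷ δ) p q = cong (d ∷_) (below-antisym γ δ p q)
below-antisym (d ∷ γ) (u ∷ δ) _ ()
below-antisym (u ∷ γ) (d ∷ δ) ()
below-antisym []      (_ ∷ _) ()
below-antisym (u ∷ γ) []      ()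
below-antisym (d ∷ γ) []      ()

data Flip : Word → Word → Set where
  valley : ∀ w → Flip (d ∷ u ∷ w) (u ∷ d ∷ w)
  skip   : ∀ s {γ δ} → Flip γ δ → Flip (s ∷ γ) (s ∷ δ)

Flip⇒below : ∀ k {γ δ} → Flip γ δ → below k γ δ ≡ true
Flip⇒below k (valley w) = below-refl k w
Flip⇒below k (skip u f) = Flip⇒below k f
Flip⇒below k (skip d f) = Flip⇒below k f

Flip⇒wordEq≡false : ∀ {γ δ} → Flip γ δ → wordEq γ δ ≡ false
Flip⇒wordEq≡false (valley w) = refl
Flip⇒wordEq≡false (skip u f) = Flip⇒wordEq≡false f
Flip⇒wordEq≡false (skip d f) = Flip⇒wordEq≡false f

Flip-between : ∀ {γ δ} → Flip γ δ → ∀ ε → below 0 γ ε ≡ true → below 0 ε δ ≡ true → ε ≡ γ ⊎ ε ≡ δ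
Flip-between (valley w) (d ∷ u ∷ ε) p q = inj₁ (cong (λ v → d ∷ u ∷ v) (below-antisym ε w q p))
Flip-between (valley w) (u ∷ d ∷ ε) p q = inj₂ (cong (λ v → u ∷ d ∷ v) (below-antisym ε w q p))
Flip-between (valley w) (d ∷ d ∷ ε) () _
Flip-between (valley w) (u ∷ u ∷ ε) _ ()
Flip-between (valley w) []          () _
Flip-between (valley w) (u ∷ [])    _ ()
Flip-between (valley w) (d ∷ [])    () _
Flip-between (skip u f) (u ∷ ε) p q = Sum.map (cong (u ∷_)) (cong (u ∷_)) (Flip-between f ε p q)
Flip-between (skip d f) (d ∷ ε) p q = Sum.map (cong (d ∷_)) (cong (d ∷_)) (Flip-between f ε p q)
Flip-between (skip u f) (d ∷ ε) () _
Flip-between (skip d f) (u ∷ ε) _ ()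
Flip-between (skip u f) []      () _
Flip-between (skip d f) []      () _

-- γ steps down against the step c of δ at gap g; the side condition makes the gap after this step
-- positive. The count of u's forces the descent of γ to end in a valley, and flipping it raises γ
-- only where the gap is still positive, so the flipped path stays below δ.
flip-below-descent : ∀ c g γ δ → below g (d ∷ γ) (c ∷ δ) ≡ true → c ≡ u ⊎ 0 < g →
                     g + countU (c ∷ δ) ≡ countU (d ∷ γ) →
                     Σ Word λ ε → Flip (d ∷ γ) ε × below g ε (c ∷ δ) ≡ true
flip-below-descent d zero    _ _ _ (inj₁ ()) _
flip-below-descent d zero    _ _ _ (inj₂ ()) _
flip-below-descent u g       []      []      _ _ e = ⊥-elim (m+1+n≢0 g e)
flip-below-descent d (suc g) []      []      _ _ ()
flip-below-descent u g       (u ∷ γ) (u ∷ δ) γ≤δ _ _ = u ∷ d ∷ γ , valley γ , γ≤δ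
flip-below-descent u g       (u ∷ γ) (d ∷ δ) γ≤δ _ _ = u ∷ d ∷ γ , valley γ , γ≤δ
flip-below-descent d (suc g) (u ∷ γ) (u ∷ δ) γ≤δ _ _ = u ∷ d ∷ γ , valley γ , γ≤δ
flip-below-descent d (suc g) (u ∷ γ) (d ∷ δ) γ≤δ _ _ = u ∷ d ∷ γ , valley γ , γ≤δ
flip-below-descent u g       (d ∷ γ) (s ∷ δ) γ≤δ _ e
  with ε , f , ε≤δ ← flip-below-descent s (suc g) γ δ γ≤δ (inj₂ ℕ.z<s) (trans (sym (+-suc g _)) e)
  = d ∷ ε , skip d f , ε≤δ
flip-below-descent d (suc g) (d ∷ γ) (s ∷ δ) γ≤δ _ e
  with ε , f , ε≤δ ← flip-below-descent s (suc g) γ δ γ≤δ (inj₂ ℕ.z<s) e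
  = d ∷ ε , skip d f , ε≤δ
flip-below-descent u g       []      (_ ∷ _) () _ _
flip-below-descent d (suc g) []      (_ ∷ _) () _ _
flip-below-descent u g       (u ∷ _) []      () _ _
flip-below-descent u g       (d ∷ _) []      () _ _
flip-below-descent d (suc g) (u ∷ _) []      () _ _
flip-below-descent d (suc g) (d ∷ _) []      () _ _

flip-toward : ∀ γ δ → below 0 γ δ ≡ true → wordEq γ δ ≡ false → countU δ ≡ countU γ →
              Σ Word λ ε → Flip γ ε × below 0 ε δ ≡ true
flip-toward (u ∷ γ) (u ∷ δ) γ≤δ γ≢δ e
  with ε , f , ε≤δ ← flip-toward γ δ γ≤δ γ≢δ (suc-injective e)
  = u ∷ ε , skip u f , ε≤δ
flip-toward (d ∷ γ) (d ∷ δ) γ≤δ γ≢δ e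
  with ε , f , ε≤δ ← flip-toward γ δ γ≤δ γ≢δ e
  = d ∷ ε , skip d f , ε≤δ
flip-toward (d ∷ γ) (u ∷ δ) γ≤δ _ e = flip-below-descent u 0 γ δ γ≤δ (inj₁ refl) e
flip-toward []      []      _  () _
flip-toward (u ∷ γ) (d ∷ δ) () _ _
flip-toward []      (_ ∷ _) () _ _
flip-toward (u ∷ _) []      () _ _
flip-toward (d ∷ _) []      () _ _

does⇒ : ∀ {P : Set} (p? : Dec P) → does p? ≡ true → P
does⇒ (yes p) _  = p
does⇒ (no _)  ()

nonnegative : ℤ → Bool
nonnegative h = does (0ℤ ℤ.≤? h)

isDyck-elim : ∀ {n γ} → isDyck n γ ≡ true →
              countU γ ≡ n × countD γ ≡ n × allB (map nonnegative (heights γ)) ≡ true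
isDyck-elim {n} {γ} dyck =
  does⇒ (countU γ ℕ.≟ n) (∧-conicalˡ #u _ dyck) ,
  does⇒ (countD γ ℕ.≟ n) (∧-conicalˡ #d nn rest) ,
  ∧-conicalʳ #d nn rest
  where
  #u #d nn : Bool
  #u = countU γ ℕ.≡ᵇ n
  #d = countD γ ℕ.≡ᵇ n
  nn = allB (map nonnegative (heights γ))
  rest : #d ∧ nn ≡ true
  rest = ∧-conicalʳ #u (#d ∧ nn) dyck

isDyck-intro : ∀ {n γ} → countU γ ≡ n → countD γ ≡ n → allB (map nonnegative (heights γ)) ≡ true →
               isDyck n γ ≡ true
isDyck-intro {n} {γ} #u #d nn
  rewrite Equivalence.to T-≡ (≡⇒≡ᵇ (countU γ) n #u) | Equivalence.to T-≡ (≡⇒≡ᵇ (countD γ) n #d) = nn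

length≡countU+countD : ∀ γ → length γ ≡ countU γ + countD γ
length≡countU+countD []      = refl
length≡countU+countD (u ∷ γ) = cong suc (length≡countU+countD γ)
length≡countU+countD (d ∷ γ) = trans (cong suc (length≡countU+countD γ)) (sym (+-suc (countU γ) (countD γ)))

isDyck⇒length : ∀ {n γ} → isDyck n γ ≡ true → length γ ≡ 2 * n
isDyck⇒length {n} {γ} dyck with #u , #d , _ ← isDyck-elim {n} {γ} dyck = begin
  length γ            ≡⟨ length≡countU+countD γ ⟩
  countU γ + countD γ ≡⟨ cong₂ _+_ #u #d ⟩
  n + n               ≡⟨ cong (n +_) (sym (+-identityʳ n)) ⟩
  2 * n               ∎
  where open ≡-Reasoning

Flip-countU : ∀ {γ δ} → Flip γ δ → countU γ ≡ countU δ
Flip-countU (valley w) = refl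
Flip-countU (skip u f) = cong suc (Flip-countU f)
Flip-countU (skip d f) = Flip-countU f

Flip-countD : ∀ {γ δ} → Flip γ δ → countD γ ≡ countD δ
Flip-countD (valley w) = refl
Flip-countD (skip u f) = Flip-countD f
Flip-countD (skip d f) = cong suc (Flip-countD f)

allB-nonnegative-mono : ∀ hs hs' → leList hs hs' ≡ true →
                        allB (map nonnegative hs) ≡ true → allB (map nonnegative hs') ≡ true
allB-nonnegative-mono []       []         _  _  = refl
allB-nonnegative-mono (h ∷ hs) (h' ∷ hs') le nn
  rewrite dec-true (0ℤ ℤ.≤? h')
            (ℤ.≤-trans (does⇒ (0ℤ ℤ.≤? h) (∧-conicalˡ _ _ nn)) (does⇒ (h ℤ.≤? h') (∧-conicalˡ _ _ le)))
  = allB-nonnegative-mono hs hs' (∧-conicalʳ _ _ le) (∧-conicalʳ _ _ nn)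

Flip-isDyck : ∀ {n γ δ} → Flip γ δ → isDyck n γ ≡ true → isDyck n δ ≡ true
Flip-isDyck {n} {γ} {δ} f dyck with #u , #d , nn ← isDyck-elim {n} {γ} dyck =
  isDyck-intro {n} {δ} (trans (sym (Flip-countU f)) #u) (trans (sym (Flip-countD f)) #d)
               (allB-nonnegative-mono (heights γ) (heights δ) (trans (≤D≡below γ δ) (Flip⇒below 0 f)) nn)

mult : Word → List Word → ℕ
mult w ws = ∑[ v ∈ ws ] 𝟙 (wordEq v w)

mult≢0⇒∈ : ∀ {w} ws → mult w ws ≢ 0 → w ∈ ws
mult≢0⇒∈     []       m≢0 = ⊥-elim (m≢0 refl)
mult≢0⇒∈ {w} (v ∷ vs) m≢0 with wordEq v w in v≡w
... | true  = here (sym (wordEq⇒≡ v≡w))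
... | false = there (mult≢0⇒∈ vs m≢0)

mult-map-∷ : ∀ s t w ws → mult (t ∷ w) (map (s ∷_) ws) ≡ 𝟙 (stepEq s t) * mult w ws
mult-map-∷ s t w ws = begin
  mult (t ∷ w) (map (s ∷_) ws)                         ≡⟨ ∑-map (s ∷_) ws _ ⟩
  ∑[ v ∈ ws ] 𝟙 (stepEq s t ∧ wordEq v w)              ≡⟨ ∑-cong ws (λ {v} _ → 𝟙-∧ (stepEq s t) (wordEq v w)) ⟩
  ∑[ v ∈ ws ] 𝟙 (stepEq s t) * 𝟙 (wordEq v w)          ≡⟨ ∑-*ˡ ws (𝟙 (stepEq s t)) _ ⟩
  𝟙 (stepEq s t) * mult w ws                           ∎
  where open ≡-Reasoning

mult-map-∷-same : ∀ s w ws → mult (s ∷ w) (map (s ∷_) ws) ≡ mult w ws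
mult-map-∷-same u w ws = trans (mult-map-∷ u u w ws) (*-identityˡ _)
mult-map-∷-same d w ws = trans (mult-map-∷ d d w ws) (*-identityˡ _)

mult-[]-map-∷ : ∀ s ws → mult [] (map (s ∷_) ws) ≡ 0
mult-[]-map-∷ s ws = trans (∑-map (s ∷_) ws _) (∑-0 ws)

mult-words : ∀ k w → length w ≡ k → mult w (words k) ≡ 1
mult-words zero    []      _ = refl
mult-words (suc k) (s ∷ w) e =
  trans (∑-concatMap (λ v → (u ∷ v) ∷ (d ∷ v) ∷ []) (words k) _)
        (trans (∑-cong (words k) (λ {v} _ → one-extension s v)) (mult-words k w (suc-injective e)))
  where
  one-extension : ∀ s v → mult (s ∷ w) ((u ∷ v) ∷ (d ∷ v) ∷ []) ≡ 𝟙 (wordEq v w)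
  one-extension u v = +-identityʳ _
  one-extension d v = +-identityʳ _

mult-filter : ∀ (p : Word → Bool) {w} ws → p w ≡ true → mult w (filter (λ v → T? (p v)) ws) ≡ mult w ws
mult-filter p     []       _  = refl
mult-filter p {w} (v ∷ vs) pw with p v in pv
... | true  = cong (𝟙 (wordEq v w) +_) (mult-filter p vs pw)
... | false with wordEq v w in v≡w
...   | false = mult-filter p vs pw
...   | true with () ← trans (sym pv) (trans (cong p (wordEq⇒≡ v≡w)) pw)

mult-Dyck : ∀ {n w} → isDyck n w ≡ true → mult w (Dyck n) ≡ 1
mult-Dyck {n} {w} dyck =
  trans (mult-filter (isDyck n) {w} (words (2 * n)) dyck) (mult-words (2 * n) w (isDyck⇒length {n} {w} dyck))

isDyck⇒∈Dyck : ∀ {n w} → isDyck n w ≡ true → w ∈ Dyck n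
isDyck⇒∈Dyck {n} {w} dyck = mult≢0⇒∈ (Dyck n) λ m≡0 → 1+n≢0 (trans (sym (mult-Dyck {n} {w} dyck)) m≡0)

∈Dyck⇒isDyck : ∀ {n w} → w ∈ Dyck n → isDyck n w ≡ true
∈Dyck⇒isDyck {n} w∈ = Equivalence.to T-≡ (proj₂ (∈-filter⁻ (λ v → T? (isDyck n v)) {xs = words (2 * n)} w∈))

∑-mult-transpose : ∀ D M (g : Word → ℕ) → ∑[ b ∈ D ] mult b M * g b ≡ ∑[ m ∈ M ] mult m D * g m
∑-mult-transpose D M g = begin
  ∑[ b ∈ D ] mult b M * g b                    ≡⟨ ∑-cong D (λ {b} _ → sym (∑-*ʳ M (g b) _)) ⟩
  ∑[ b ∈ D ] ∑[ m ∈ M ] 𝟙 (wordEq m b) * g b   ≡⟨ ∑-comm D M _ ⟩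
  ∑[ m ∈ M ] ∑[ b ∈ D ] 𝟙 (wordEq m b) * g b   ≡⟨ ∑-cong M (λ {m} _ → ∑-cong D (λ {b} _ → transpose m b)) ⟩
  ∑[ m ∈ M ] ∑[ b ∈ D ] 𝟙 (wordEq b m) * g m   ≡⟨ ∑-cong M (λ {m} _ → ∑-*ʳ D (g m) _) ⟩
  ∑[ m ∈ M ] mult m D * g m                    ∎
  where
  open ≡-Reasoning
  transpose : ∀ m b → 𝟙 (wordEq m b) * g b ≡ 𝟙 (wordEq b m) * g m
  transpose m b rewrite wordEq-sym m b with wordEq b m in b≡m
  ... | true  = cong (λ v → 1 * g v) (wordEq⇒≡ b≡m)
  ... | false = refl

flips : Word → List Word
flips []          = []
flips (d ∷ u ∷ w) = (u ∷ d ∷ w) ∷ map (d ∷_) (flips (u ∷ w))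
flips (s ∷ w)     = map (s ∷_) (flips w)

∈flips⇒Flip : ∀ γ {δ} → δ ∈ flips γ → Flip γ δ
∈flips⇒Flip (u ∷ γ) δ∈
  with δ' , δ'∈ , refl ← ∈-map⁻ (u ∷_) δ∈ = skip u (∈flips⇒Flip γ δ'∈)
∈flips⇒Flip (d ∷ u ∷ γ) (here refl) = valley γ
∈flips⇒Flip (d ∷ u ∷ γ) (there δ∈)
  with δ' , δ'∈ , refl ← ∈-map⁻ (d ∷_) δ∈ = skip d (∈flips⇒Flip (u ∷ γ) δ'∈)
∈flips⇒Flip (d ∷ d ∷ γ) δ∈
  with δ' , δ'∈ , refl ← ∈-map⁻ (d ∷_) δ∈ = skip d (∈flips⇒Flip (d ∷ γ) δ'∈)

Flip⇒mult-flips≡1 : ∀ {γ δ} → Flip γ δ → mult δ (flips γ) ≡ 1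
Flip⇒mult-flips≡1 (valley w) rewrite wordEq-refl w | mult-map-∷ d u (d ∷ w) (flips (u ∷ w)) = refl
Flip⇒mult-flips≡1 (skip u {γ} {δ} f) = trans (mult-map-∷-same u δ (flips γ)) (Flip⇒mult-flips≡1 f)
Flip⇒mult-flips≡1 (skip d {u ∷ γ} {δ} f) = trans (mult-map-∷-same d δ (flips (u ∷ γ))) (Flip⇒mult-flips≡1 f)
Flip⇒mult-flips≡1 (skip d {d ∷ γ} {δ} f) = trans (mult-map-∷-same d δ (flips (d ∷ γ))) (Flip⇒mult-flips≡1 f)

mult-[]-flips : ∀ γ → mult [] (flips γ) ≡ 0
mult-[]-flips []          = refl
mult-[]-flips (u ∷ γ)     = mult-[]-map-∷ u (flips γ)
mult-[]-flips (d ∷ [])    = refl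
mult-[]-flips (d ∷ u ∷ γ) = mult-[]-map-∷ d (flips (u ∷ γ))
mult-[]-flips (d ∷ d ∷ γ) = mult-[]-map-∷ d (flips (d ∷ γ))

mult-flips≡0⊎Flip : ∀ γ δ → mult δ (flips γ) ≡ 0 ⊎ Flip γ δ
mult-flips≡0⊎Flip γ           []      = inj₁ (mult-[]-flips γ)
mult-flips≡0⊎Flip []          (_ ∷ _) = inj₁ refl
mult-flips≡0⊎Flip (u ∷ γ)     (u ∷ δ) =
  Sum.map (trans (mult-map-∷-same u δ (flips γ))) (skip u) (mult-flips≡0⊎Flip γ δ)
mult-flips≡0⊎Flip (u ∷ γ)     (d ∷ δ) = inj₁ (mult-map-∷ u d δ (flips γ))
mult-flips≡0⊎Flip (d ∷ [])    (_ ∷ _) = inj₁ refl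
mult-flips≡0⊎Flip (d ∷ u ∷ γ) (u ∷ δ) rewrite mult-map-∷ d u δ (flips (u ∷ γ)) with wordEq (d ∷ γ) δ in e
... | true  = inj₂ (subst (λ v → Flip (d ∷ u ∷ γ) (u ∷ v)) (wordEq⇒≡ e) (valley γ))
... | false = inj₁ refl
mult-flips≡0⊎Flip (d ∷ u ∷ γ) (d ∷ δ) =
  Sum.map (trans (mult-map-∷-same d δ (flips (u ∷ γ)))) (skip d) (mult-flips≡0⊎Flip (u ∷ γ) δ)
mult-flips≡0⊎Flip (d ∷ d ∷ γ) (u ∷ δ) = inj₁ (mult-map-∷ d u δ (flips (d ∷ γ)))
mult-flips≡0⊎Flip (d ∷ d ∷ γ) (d ∷ δ) =
  Sum.map (trans (mult-map-∷-same d δ (flips (d ∷ γ)))) (skip d) (mult-flips≡0⊎Flip (d ∷ γ) δ)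

-- Covers are valley flips

anyB-map-false : ∀ {f : Word → Bool} → (∀ x → f x ≡ false) → ∀ xs → anyB (map f xs) ≡ false
anyB-map-false f≡false []       = refl
anyB-map-false f≡false (x ∷ xs) rewrite f≡false x = anyB-map-false f≡false xs

anyB-map-false⁻ : ∀ (f : Word → Bool) {x} xs → anyB (map f xs) ≡ false → x ∈ xs → f x ≡ false
anyB-map-false⁻ f (y ∷ ys) none (here refl) = ∨-conicalˡ (f y) _ none
anyB-map-false⁻ f (y ∷ ys) none (there x∈) = anyB-map-false⁻ f ys (∨-conicalʳ (f y) _ none) x∈

<D⇒below : ∀ {γ δ} → (γ <D δ) ≡ true → below 0 γ δ ≡ true × wordEq γ δ ≡ false
<D⇒below {γ} {δ} γ<δ =
  trans (sym (≤D≡below γ δ)) (∧-conicalˡ (γ ≤D δ) _ γ<δ) , not-injective (∧-conicalʳ (γ ≤D δ) _ γ<δ)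

below∧≮D⇒≡ : ∀ {γ δ} → below 0 γ δ ≡ true → (γ <D δ) ≡ false → γ ≡ δ
below∧≮D⇒≡ {γ} {δ} γ≤δ γ≮δ =
  wordEq⇒≡ (not-injective (trans (cong (_∧ not (wordEq γ δ)) (sym (trans (≤D≡below γ δ) γ≤δ))) γ≮δ))

Flip⇒<D : ∀ {γ δ} → Flip γ δ → (γ <D δ) ≡ true
Flip⇒<D {γ} {δ} f rewrite ≤D≡below γ δ | Flip⇒below 0 f | Flip⇒wordEq≡false f = refl

Flip-no-middle : ∀ {γ δ} → Flip γ δ → ∀ ε → ((γ <D ε) ∧ (ε <D δ)) ≡ false
Flip-no-middle {γ} {δ} f ε with γ <D ε in γ<ε | ε <D δ in ε<δ
... | false | _     = refl
... | true  | false = refl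
... | true  | true
  with γ≤ε , γ≢ε ← <D⇒below {γ} {ε} γ<ε | ε≤δ , ε≢δ ← <D⇒below {ε} {δ} ε<δ
     | Flip-between f ε γ≤ε ε≤δ
... | inj₁ refl with () ← trans (sym (wordEq-refl γ)) γ≢ε
... | inj₂ refl with () ← trans (sym (wordEq-refl δ)) ε≢δ

Flip⇒covers : ∀ n {γ δ} → Flip γ δ → covers n γ δ ≡ true
Flip⇒covers n f rewrite Flip⇒<D f | anyB-map-false (Flip-no-middle f) (Dyck n) = refl

covers⇒Flip : ∀ {n γ δ} → isDyck n γ ≡ true → isDyck n δ ≡ true → covers n γ δ ≡ true → Flip γ δ
covers⇒Flip {n} {γ} {δ} dγ dδ cov
  with γ≤δ , γ≢δ ← <D⇒below {γ} {δ} (∧-conicalˡ (γ <D δ) _ cov)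
  with ε , f , ε≤δ ← flip-toward γ δ γ≤δ γ≢δ
                       (trans (proj₁ (isDyck-elim {n} {δ} dδ)) (sym (proj₁ (isDyck-elim {n} {γ} dγ))))
  = subst (Flip γ) (below∧≮D⇒≡ ε≤δ ε≮δ) f
  where
  nothing-between : anyB (map (λ ε → (γ <D ε) ∧ (ε <D δ)) (Dyck n)) ≡ false
  nothing-between = not-injective (∧-conicalʳ (γ <D δ) _ cov)
  ε≮δ : (ε <D δ) ≡ false
  ε≮δ = trans (cong (_∧ (ε <D δ)) (sym (Flip⇒<D f)))
              (anyB-map-false⁻ _ (Dyck n) nothing-between (isDyck⇒∈Dyck {n} {ε} (Flip-isDyck {n} f dγ)))

mult-flips≡𝟙-covers : ∀ {n γ δ} → isDyck n γ ≡ true → isDyck n δ ≡ true →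
                      mult δ (flips γ) ≡ 𝟙 (covers n γ δ)
mult-flips≡𝟙-covers {n} {γ} {δ} dγ dδ with covers n γ δ in cov
... | true = Flip⇒mult-flips≡1 (covers⇒Flip {n} {γ} {δ} dγ dδ cov)
... | false with mult-flips≡0⊎Flip γ δ
...   | inj₁ m≡0 = m≡0
...   | inj₂ f with () ← trans (sym cov) (Flip⇒covers n f)

∑-covers : ∀ {n γ} → isDyck n γ ≡ true → ∀ (g : Word → ℕ) →
           ∑[ δ ∈ Dyck n ] 𝟙 (covers n γ δ) * g δ ≡ ∑ (flips γ) g
∑-covers {n} {γ} dγ g = begin
  ∑[ δ ∈ Dyck n ] 𝟙 (covers n γ δ) * g δ
    ≡⟨ ∑-cong (Dyck n) (λ {δ} δ∈ →
         cong (_* g δ) (sym (mult-flips≡𝟙-covers {n} {γ} {δ} dγ (∈Dyck⇒isDyck δ∈)))) ⟩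
  ∑[ δ ∈ Dyck n ] mult δ (flips γ) * g δ
    ≡⟨ ∑-mult-transpose (Dyck n) (flips γ) g ⟩
  ∑[ ε ∈ flips γ ] mult ε (Dyck n) * g ε
    ≡⟨ ∑-cong (flips γ) (λ {ε} ε∈ →
         trans (cong (_* g ε) (mult-Dyck {n} {ε} (Flip-isDyck {n} (∈flips⇒Flip γ ε∈) dγ))) (*-identityˡ (g ε))) ⟩
  ∑ (flips γ) g
    ∎
  where open ≡-Reasoning

-- Valleys and the factors ddu, duu

-- Like occAux, this also counts the position at the end of γ, which matters only for p = [].
#factor : Word → Word → ℕ
#factor p []      = 𝟙 (isPrefix p [])
#factor p (s ∷ γ) = 𝟙 (isPrefix p (s ∷ γ)) + #factor p γ

length-if-singleton : ∀ b (x : ℕ) → length (if b then x ∷ [] else []) ≡ 𝟙 b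
length-if-singleton true  x = refl
length-if-singleton false x = refl

length-occAux : ∀ p i γ → length (occAux p i γ) ≡ #factor p γ
length-occAux p i []      = length-if-singleton (isPrefix p []) i
length-occAux p i (s ∷ γ) =
  trans (length-++ (if isPrefix p (s ∷ γ) then i ∷ [] else []))
        (cong₂ _+_ (length-if-singleton (isPrefix p (s ∷ γ)) i) (length-occAux p (suc i) γ))

#occ≡#factor : ∀ p γ → #occ p γ ≡ #factor p γ
#occ≡#factor p γ = length-occAux p 0 γ

valleys : Word → ℕ
valleys = #factor (d ∷ u ∷ [])

startsUp : Word → ℕ
startsUp γ = 𝟙 (isPrefix (u ∷ []) γ)

length-flips : ∀ γ → length (flips γ) ≡ valleys γ
length-flips []          = refl
length-flips (u ∷ γ)     = trans (length-map (u ∷_) (flips γ)) (length-flips γ)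
length-flips (d ∷ [])    = refl
length-flips (d ∷ u ∷ γ) = cong suc (trans (length-map (d ∷_) (flips (u ∷ γ))) (length-flips (u ∷ γ)))
length-flips (d ∷ d ∷ γ) = trans (length-map (d ∷_) (flips (d ∷ γ))) (length-flips (d ∷ γ))

∑-startsUp-map-d∷ : ∀ δs → ∑ (map (d ∷_) δs) startsUp ≡ 0
∑-startsUp-map-d∷ δs = trans (∑-map (d ∷_) δs startsUp) (∑-0 δs)

∑-startsUp-flips-u∷ : ∀ γ → ∑ (flips (u ∷ γ)) startsUp ≡ valleys γ
∑-startsUp-flips-u∷ γ = trans (∑-map (u ∷_) (flips γ) startsUp) (trans (∑-1 (flips γ)) (length-flips γ))

∑-startsUp-flips-d∷ : ∀ γ → ∑ (flips (d ∷ γ)) startsUp ≡ startsUp γ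
∑-startsUp-flips-d∷ []      = refl
∑-startsUp-flips-d∷ (u ∷ γ) = cong suc (∑-startsUp-map-d∷ (flips (u ∷ γ)))
∑-startsUp-flips-d∷ (d ∷ γ) = ∑-startsUp-map-d∷ (flips (d ∷ γ))

C2-suc : ∀ m → suc m C 2 ≡ m + m C 2
C2-suc m = trans (sym (nCk+nC[k+1]≡[n+1]C[k+1] m 1)) (cong (_+ m C 2) (nC1≡n m))

∑-valleys-flips : ∀ γ → ∑ (flips γ) valleys
                        ≡ 2 * (valleys γ C 2) + #factor (d ∷ d ∷ u ∷ []) γ + #factor (d ∷ u ∷ u ∷ []) γ
∑-valleys-flips []          = refl
∑-valleys-flips (u ∷ γ)     = trans (∑-map (u ∷_) (flips γ) valleys) (∑-valleys-flips γ)
∑-valleys-flips (d ∷ [])    = refl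
∑-valleys-flips (d ∷ u ∷ γ) = begin
  valleys (d ∷ γ) + ∑ (map (d ∷_) (flips (u ∷ γ))) valleys
    ≡⟨ cong (valleys (d ∷ γ) +_)
            (trans (∑-map (d ∷_) (flips (u ∷ γ)) valleys) (∑-+ (flips (u ∷ γ)) startsUp valleys)) ⟩
  valleys (d ∷ γ) + (∑ (flips (u ∷ γ)) startsUp + ∑ (flips (u ∷ γ)) valleys)
    ≡⟨ cong₂ (λ x y → valleys (d ∷ γ) + (x + y)) (∑-startsUp-flips-u∷ γ) (∑-valleys-flips (u ∷ γ)) ⟩
  (startsUp γ + v) + (v + (2 * (v C 2) + #ddu + #duu))
    ≡⟨ rearrange (startsUp γ) v (v C 2) #ddu #duu ⟩
  2 * (v + v C 2) + #ddu + (startsUp γ + #duu)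
    ≡⟨ cong (λ x → 2 * x + #ddu + (startsUp γ + #duu)) (sym (C2-suc v)) ⟩
  2 * (suc v C 2) + #ddu + (startsUp γ + #duu)
    ∎
  where
  open ≡-Reasoning
  v = valleys γ
  #ddu = #factor (d ∷ d ∷ u ∷ []) γ
  #duu = #factor (d ∷ u ∷ u ∷ []) γ
  rearrange : ∀ s v c a b → (s + v) + (v + (2 * c + a + b)) ≡ 2 * (v + c) + a + (s + b)
  rearrange = ℕ-Ring.solve-∀
∑-valleys-flips (d ∷ d ∷ γ) = begin
  ∑ (map (d ∷_) (flips (d ∷ γ))) valleys
    ≡⟨ trans (∑-map (d ∷_) (flips (d ∷ γ)) valleys) (∑-+ (flips (d ∷ γ)) startsUp valleys) ⟩
  ∑ (flips (d ∷ γ)) startsUp + ∑ (flips (d ∷ γ)) valleys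
    ≡⟨ cong₂ _+_ (∑-startsUp-flips-d∷ γ) (∑-valleys-flips (d ∷ γ)) ⟩
  startsUp γ + (2 * (valleys (d ∷ γ) C 2) + #ddu + #duu)
    ≡⟨ rearrange (startsUp γ) (2 * (valleys (d ∷ γ) C 2)) #ddu #duu ⟩
  2 * (valleys (d ∷ γ) C 2) + (startsUp γ + #ddu) + #duu
    ∎
  where
  open ≡-Reasoning
  #ddu = #factor (d ∷ d ∷ u ∷ []) (d ∷ γ)
  #duu = #factor (d ∷ u ∷ u ∷ []) (d ∷ γ)
  rearrange : ∀ s x a b → s + (x + a + b) ≡ x + (s + a) + b
  rearrange = ℕ-Ring.solve-∀

𝟙-≤ᵇ : ∀ {m n} → m ≤ n → 𝟙 (m ≤ᵇ n) ≡ 1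
𝟙-≤ᵇ {m} {n} m≤n = cong 𝟙 (dec-true (m ℕ.≤? n) m≤n)

𝟙-≰ᵇ : ∀ {m n} → ¬ m ≤ n → 𝟙 (m ≤ᵇ n) ≡ 0
𝟙-≰ᵇ {m} {n} m≰n = cong 𝟙 (dec-false (m ℕ.≤? n) m≰n)

∑∑-separated-pairs : ∀ k {is} → AllPairs (λ i j → i + suc k ≤ j) is →
                     ∑[ i ∈ is ] ∑[ j ∈ is ] 𝟙 (i + suc k ≤ᵇ j) ≡ length is C 2
∑∑-separated-pairs k {[]}     []           = refl
∑∑-separated-pairs k {i ∷ is} (i≪is ∷ sep) = begin
  (𝟙 (i + suc k ≤ᵇ i) + ∑[ j ∈ is ] 𝟙 (i + suc k ≤ᵇ j))
    + ∑[ i' ∈ is ] (𝟙 (i' + suc k ≤ᵇ i) + ∑[ j ∈ is ] 𝟙 (i' + suc k ≤ᵇ j))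
    ≡⟨ cong₂ _+_ (cong₂ _+_ (𝟙-≰ᵇ (m+1+n≰m i)) later) (∑-cong is λ i'∈ → cong (_+ _) (earlier i'∈)) ⟩
  length is + ∑[ i' ∈ is ] ∑[ j ∈ is ] 𝟙 (i' + suc k ≤ᵇ j)
    ≡⟨ cong (length is +_) (∑∑-separated-pairs k sep) ⟩
  length is + length is C 2
    ≡⟨ sym (C2-suc (length is)) ⟩
  suc (length is) C 2
    ∎
  where
  open ≡-Reasoning
  later : ∑[ j ∈ is ] 𝟙 (i + suc k ≤ᵇ j) ≡ length is
  later = trans (∑-cong is (𝟙-≤ᵇ ∘ All.lookup i≪is)) (∑-1 is)
  earlier : ∀ {i'} → i' ∈ is → 𝟙 (i' + suc k ≤ᵇ i) ≡ 0
  earlier i'∈ = 𝟙-≰ᵇ λ i'+k<i →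
    m+1+n≰m _ (≤-trans i'+k<i (≤-trans (m≤m+n i (suc k)) (All.lookup i≪is i'∈)))

occAux-valleys-separated : ∀ i γ → AllPairs (λ j l → j + 2 ≤ l) (occAux (d ∷ u ∷ []) i γ)
                                  × All (i ≤_) (occAux (d ∷ u ∷ []) i γ)
occAux-valleys-separated i []          = [] , []
occAux-valleys-separated i (u ∷ γ)     with sep , bound ← occAux-valleys-separated (suc i) γ
  = sep , All.map (≤-trans (n≤1+n i)) bound
occAux-valleys-separated i (d ∷ [])    = [] , []
occAux-valleys-separated i (d ∷ u ∷ γ) with sep , bound ← occAux-valleys-separated (suc (suc i)) γ
  = All.map (λ {j} 2+i≤j → subst (_≤ j) (+-comm 2 i) 2+i≤j) bound ∷ sep
  , ≤-refl ∷ All.map (≤-trans (≤-trans (n≤1+n i) (n≤1+n (suc i)))) bound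
occAux-valleys-separated i (d ∷ d ∷ γ) with sep , bound ← occAux-valleys-separated (suc i) (d ∷ γ)
  = sep , All.map (≤-trans (n≤1+n i)) bound

#occPair-du≡valleys-C2 : ∀ γ → #occPair (d ∷ u ∷ []) γ ≡ valleys γ C 2
#occPair-du≡valleys-C2 γ = begin
  #occPair (d ∷ u ∷ []) γ
    ≡⟨ length-filter≡∑ (λ b → b) (concatMap (λ i → map (λ j → i + 2 ≤ᵇ j) O) O) ⟩
  ∑ (concatMap (λ i → map (λ j → i + 2 ≤ᵇ j) O) O) 𝟙
    ≡⟨ ∑-concatMap (λ i → map (λ j → i + 2 ≤ᵇ j) O) O 𝟙 ⟩
  ∑[ i ∈ O ] ∑ (map (λ j → i + 2 ≤ᵇ j) O) 𝟙
    ≡⟨ ∑-cong O (λ {i} _ → ∑-map (λ j → i + 2 ≤ᵇ j) O 𝟙) ⟩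
  ∑[ i ∈ O ] ∑[ j ∈ O ] 𝟙 (i + 2 ≤ᵇ j)
    ≡⟨ ∑∑-separated-pairs 1 (proj₁ (occAux-valleys-separated 0 γ)) ⟩
  length O C 2
    ≡⟨ cong (_C 2) (length-occAux (d ∷ u ∷ []) 0 γ) ⟩
  valleys γ C 2
    ∎
  where
  open ≡-Reasoning
  O = occurrences (d ∷ u ∷ []) γ

sc2≡∑∑∑ : ∀ n →
          sc2 n ≡ ∑[ α ∈ Dyck n ] ∑[ β ∈ Dyck n ] ∑[ γ ∈ Dyck n ] 𝟙 (covers n α β ∧ covers n β γ)
sc2≡∑∑∑ n =
  trans (length-filter≡∑ _ (concatMap (λ α → concatMap (λ β → map (λ γ → α ∷ β ∷ γ ∷ []) D) D) D))
  (trans (∑-concatMap _ D _)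
  (∑-cong D λ {α} _ → trans (∑-concatMap _ D _) (∑-cong D λ {β} _ → ∑-map (λ γ → α ∷ β ∷ γ ∷ []) D _)))
  where D = Dyck n

∑-chains-through : ∀ {n β} → isDyck n β ≡ true → ∀ α →
                   ∑[ γ ∈ Dyck n ] 𝟙 (covers n α β ∧ covers n β γ) ≡ 𝟙 (covers n α β) * valleys β
∑-chains-through {n} {β} dβ α = begin
  ∑[ γ ∈ Dyck n ] 𝟙 (covers n α β ∧ covers n β γ)
    ≡⟨ ∑-cong (Dyck n) (λ {γ} _ → 𝟙-∧ (covers n α β) (covers n β γ)) ⟩
  ∑[ γ ∈ Dyck n ] 𝟙 (covers n α β) * 𝟙 (covers n β γ)
    ≡⟨ ∑-*ˡ (Dyck n) (𝟙 (covers n α β)) _ ⟩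
  𝟙 (covers n α β) * (∑[ γ ∈ Dyck n ] 𝟙 (covers n β γ))
    ≡⟨ cong (𝟙 (covers n α β) *_) upper-covers ⟩
  𝟙 (covers n α β) * valleys β
    ∎
  where
  open ≡-Reasoning
  upper-covers : ∑[ γ ∈ Dyck n ] 𝟙 (covers n β γ) ≡ valleys β
  upper-covers = begin
    ∑[ γ ∈ Dyck n ] 𝟙 (covers n β γ)     ≡⟨ ∑-cong (Dyck n) (λ _ → sym (*-identityʳ _)) ⟩
    ∑[ γ ∈ Dyck n ] 𝟙 (covers n β γ) * 1 ≡⟨ ∑-covers {n} {β} dβ (λ _ → 1) ⟩
    ∑[ γ ∈ flips β ] 1                   ≡⟨ ∑-1 (flips β) ⟩
    length (flips β)                     ≡⟨ length-flips β ⟩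
    valleys β                            ∎

mainTheorem2 : (n : ℕ) →
    sc2 n ≡ sumOver (Dyck n) (λ γ →
    2 * #occPair (d ∷ u ∷ []) γ + #occ (d ∷ d ∷ u ∷ []) γ + #occ (d ∷ u ∷ u ∷ []) γ)
mainTheorem2 n = begin
  sc2 n
    ≡⟨ sc2≡∑∑∑ n ⟩
  ∑[ α ∈ D ] ∑[ β ∈ D ] ∑[ γ ∈ D ] 𝟙 (covers n α β ∧ covers n β γ)
    ≡⟨ ∑-cong D (λ {α} _ → ∑-cong D λ {β} β∈ → ∑-chains-through {n} {β} (∈Dyck⇒isDyck {n} β∈) α) ⟩
  ∑[ α ∈ D ] ∑[ β ∈ D ] 𝟙 (covers n α β) * valleys β
    ≡⟨ ∑-cong D (λ {α} α∈ → ∑-covers {n} {α} (∈Dyck⇒isDyck {n} α∈) valleys) ⟩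
  ∑[ α ∈ D ] ∑ (flips α) valleys
    ≡⟨ ∑-cong D (λ {α} _ → ∑-valleys-flips α) ⟩
  ∑[ α ∈ D ] (2 * (valleys α C 2) + #factor (d ∷ d ∷ u ∷ []) α + #factor (d ∷ u ∷ u ∷ []) α)
    ≡⟨ ∑-cong D (λ {α} _ → sym (cong₂ _+_ (cong₂ _+_ (cong (2 *_) (#occPair-du≡valleys-C2 α))
                                                       (#occ≡#factor (d ∷ d ∷ u ∷ []) α))
                                          (#occ≡#factor (d ∷ u ∷ u ∷ []) α))) ⟩
  sumOver D (λ γ → 2 * #occPair (d ∷ u ∷ []) γ + #occ (d ∷ d ∷ u ∷ []) γ + #occ (d ∷ u ∷ u ∷ []) γ)
    ∎
  where
  open ≡-Reasoning
  D = Dyck n
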